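{- Let $r\ge 2$ be an integer, $\alpha=\sqrt{r}$, $a(n)=\lfloor n/\alpha+\alpha/2\rfloor$ for $n\in\mathbb{Z}$, $S(n)=\sum_{j=0}^{r-1}a(n-j)$, and \[ \Phi(n)=\sum_{j=0}^{r-1}\Bigl\{\frac{n-j}{\alpha}+\frac{\alpha}{2}\Bigr\}. \] Then for all integers $n\ge r$, \[ a(S(n))=n\iff \frac{r-\alpha}{2}<\Phi(n)\le \frac{r+\alpha}{2}. \]
   Context: $\{x\}=x-\lfloor x\rfloor$ denotes the fractional part. -}

module Defs where

open import Data.Nat as ℕ using (ℕ; zero; suc)
open import Data.Integer as ℤ using (ℤ; +_)
open import Data.Rational as ℚ using (ℚ; _/_; 0ℚ; ½)
open import Data.Product using (_×_)
open import Data.Sum using (_⊎_)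
open import Relation.Nullary using (¬_)

-- Real numbers of the form  p + q·√r  (p, q rational), r a fixed natural.
-- Represented by the pair (p , q); the order below is the order of the
-- corresponding real numbers p + q√r (valid whether or not r is a square).
record Q√ : Set where
  constructor _+_√
  field
    re im : ℚ
open Q√ public

infixl 6 _⊕_ _⊖_
_⊕_ : Q√ → Q√ → Q√
(a + b √) ⊕ (c + d √) = (a ℚ.+ c) + (b ℚ.+ d) √

_⊖_ : Q√ → Q√ → Q√
(a + b √) ⊖ (c + d √) = (a ℚ.- c) + (b ℚ.- d) √

ℤ→Q√ : ℤ → Q√
ℤ→Q√ m = (m / 1) + 0ℚ √

-- p + q√r ≥ 0 (as a real number), where r ≥ 0
NonNeg : ℕ → Q√ → Set
NonNeg r (p + q √) =
    (0ℚ ℚ.≤ p × 0ℚ ℚ.≤ q)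
  ⊎ (0ℚ ℚ.≤ p × q ℚ.< 0ℚ × (q ℚ.* q) ℚ.* (+ r / 1) ℚ.≤ p ℚ.* p)
  ⊎ (p ℚ.< 0ℚ × 0ℚ ℚ.≤ q × p ℚ.* p ℚ.≤ (q ℚ.* q) ℚ.* (+ r / 1))

infix 4 _≤[_]_ _<[_]_
_≤[_]_ : Q√ → ℕ → Q√ → Set
x ≤[ r ] y = NonNeg r (y ⊖ x)

_<[_]_ : Q√ → ℕ → Q√ → Set
x <[ r ] y = x ≤[ r ] y × ¬ (y ≤[ r ] x)

IsFloor : ℕ → Q√ → ℤ → Set
IsFloor r x k = ℤ→Q√ k ≤[ r ] x × x <[ r ] ℤ→Q√ (k ℤ.+ + 1)

-- 1/r as a rational (junk value 0 at r = 0, never used since r ≥ 2)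
inv : ℕ → ℚ
inv zero = 0ℚ
inv (suc k) = + 1 / suc k

α : ℕ → Q√
α r = 0ℚ + (+ 1 / 1) √

-- n/α + α/2 = (n/r + 1/2)·√r
argA : ℕ → ℤ → Q√
argA r n = 0ℚ + ((n / 1) ℚ.* inv r ℚ.+ ½) √

sumℤ : ℕ → (ℕ → ℤ) → ℤ
sumℤ zero f = + 0
sumℤ (suc k) f = sumℤ k f ℤ.+ f k

sumQ√ : ℕ → (ℕ → Q√) → Q√
sumQ√ zero f = 0ℚ + 0ℚ √
sumQ√ (suc k) f = sumQ√ k f ⊕ f k

S : ℕ → (ℤ → ℤ) → ℤ → ℤ
S r a n = sumℤ r (λ j → a (n ℤ.- + j))

-- Φ(n) = Σ_{j=0}^{r-1} { (n-j)/α + α/2 },  {x} = x - ⌊x⌋ with ⌊·⌋ = a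
Φ : ℕ → (ℤ → ℤ) → ℤ → Q√
Φ r a n = sumQ√ r (λ j → argA r (n ℤ.- + j) ⊖ ℤ→Q√ (a (n ℤ.- + j)))

lowerB upperB : ℕ → Q√
lowerB r = (+ r / 2) + (ℚ.- ½) √
upperB r = (+ r / 2) + ½ √

-- Write s = S(n) and x = s/√r + √r/2, so that a(s) = ⌊x⌋ and a(s) = n iff n ≤ x < n + 1.
-- Summing the fractional parts gives Φ(n) = (n + 1/2)√r − s, because
-- Σ_{j<r} ((n − j)/√r + √r/2) = (n + 1/2)√r. Multiplication by √r preserves the sign of
-- p + q√r (it sends it to qr + p√r), and it sends x − n to (r + √r)/2 − Φ(n) and n + 1 − x
-- to Φ(n) − (r − √r)/2, so the two floor inequalities are exactly the two bounds on Φ(n).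
module Submission where

open import Data.Integer as ℤ using (ℤ; +_)
import Data.Integer.Properties as ℤP
import Data.Integer.Tactic.RingSolver as ℤ-Ring
open import Data.Nat using (ℕ; zero; suc; _≤_)
open import Data.Product using (_×_; _,_)
open import Data.Rational as ℚ using (ℚ; _/_; 0ℚ; 1ℚ; ½; toℚᵘ)
import Data.Rational.Properties as ℚP
import Data.Rational.Unnormalised as ℚᵘ
import Data.Rational.Unnormalised.Properties as ℚᵘP
open import Data.Sum using (inj₁; inj₂)
open import Function using (_∘_)
open import Function.Construct.Composition using (_⇔-∘_)
open import Function.Bundles using (_⇔_; mk⇔; Equivalence)
open import Relation.Binary.PropositionalEquality
open import Relation.Nullary using (¬_; yes; no)
open import Relation.Nullary.Decidable using (dec⇒maybe)
open import Tactic.RingSolver using (solve-∀)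
open import Tactic.RingSolver.Core.AlmostCommutativeRing using (AlmostCommutativeRing; fromCommutativeRing)

open import Defs

open Equivalence

ℚ-ring : AlmostCommutativeRing _ _
ℚ-ring = fromCommutativeRing ℚP.+-*-commutativeRing (λ x → dec⇒maybe (0ℚ ℚP.≟ x))

fromℤ : ℤ → ℚ
fromℤ m = m / 1

toℚᵘ-fromℤ : ∀ m → toℚᵘ (fromℤ m) ℚᵘ.≃ ℚᵘ.mkℚᵘ m 0
toℚᵘ-fromℤ m = ℚP.toℚᵘ-fromℚᵘ (ℚᵘ.mkℚᵘ m 0)

fromℤ-homo-+ : ∀ m k → fromℤ (m ℤ.+ k) ≡ fromℤ m ℚ.+ fromℤ k
fromℤ-homo-+ m k = ℚP.toℚᵘ-injective (begin
  toℚᵘ (fromℤ (m ℤ.+ k))                  ≈⟨ toℚᵘ-fromℤ (m ℤ.+ k) ⟩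
  ℚᵘ.mkℚᵘ (m ℤ.+ k) 0                     ≈⟨ ℚᵘ.*≡* (eq m k) ⟩
  ℚᵘ.mkℚᵘ m 0 ℚᵘ.+ ℚᵘ.mkℚᵘ k 0            ≈⟨ ℚᵘP.+-cong (toℚᵘ-fromℤ m) (toℚᵘ-fromℤ k) ⟨
  toℚᵘ (fromℤ m) ℚᵘ.+ toℚᵘ (fromℤ k)      ≈⟨ ℚP.toℚᵘ-homo-+ (fromℤ m) (fromℤ k) ⟨
  toℚᵘ (fromℤ m ℚ.+ fromℤ k)              ∎)
  where
  open ℚᵘP.≃-Reasoning
  eq : ∀ m k → (m ℤ.+ k) ℤ.* + 1 ≡ (m ℤ.* + 1 ℤ.+ k ℤ.* + 1) ℤ.* + 1
  eq = ℤ-Ring.solve-∀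

fromℤ-homo‿- : ∀ m → fromℤ (ℤ.- m) ≡ ℚ.- fromℤ m
fromℤ-homo‿- m = ℚP.toℚᵘ-injective (begin
  toℚᵘ (fromℤ (ℤ.- m))   ≈⟨ toℚᵘ-fromℤ (ℤ.- m) ⟩
  ℚᵘ.mkℚᵘ (ℤ.- m) 0      ≈⟨ ℚᵘP.-‿cong (toℚᵘ-fromℤ m) ⟨
  ℚᵘ.- toℚᵘ (fromℤ m)    ≈⟨ ℚP.toℚᵘ-homo‿- (fromℤ m) ⟨
  toℚᵘ (ℚ.- fromℤ m)     ∎)
  where open ℚᵘP.≃-Reasoning

fromℤ-mono-≤ : ∀ {m k} → m ℤ.≤ k → fromℤ m ℚ.≤ fromℤ k
fromℤ-mono-≤ {m} {k} m≤k = ℚP.toℚᵘ-cancel-≤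
  (ℚᵘP.≤-respˡ-≃ (ℚᵘP.≃-sym (toℚᵘ-fromℤ m)) (ℚᵘP.≤-respʳ-≃ (ℚᵘP.≃-sym (toℚᵘ-fromℤ k))
    (ℚᵘ.*≤* (subst₂ ℤ._≤_ (sym (ℤP.*-identityʳ m)) (sym (ℤP.*-identityʳ k)) m≤k))))

/2≡fromℤ*½ : ∀ m → m / 2 ≡ fromℤ m ℚ.* ½
/2≡fromℤ*½ m = ℚP.toℚᵘ-injective (begin
  toℚᵘ (m / 2)                 ≈⟨ ℚP.toℚᵘ-fromℚᵘ (ℚᵘ.mkℚᵘ m 1) ⟩
  ℚᵘ.mkℚᵘ m 1                  ≈⟨ ℚᵘ.*≡* (eq m) ⟩
  ℚᵘ.mkℚᵘ m 0 ℚᵘ.* toℚᵘ ½      ≈⟨ ℚᵘP.*-congʳ (toℚᵘ-fromℤ m) ⟨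
  toℚᵘ (fromℤ m) ℚᵘ.* toℚᵘ ½   ≈⟨ ℚP.toℚᵘ-homo-* (fromℤ m) ½ ⟨
  toℚᵘ (fromℤ m ℚ.* ½)         ∎)
  where
  open ℚᵘP.≃-Reasoning
  eq : ∀ m → m ℤ.* + 2 ≡ (m ℤ.* + 1) ℤ.* + 2
  eq = ℤ-Ring.solve-∀

fromℤ*inv : ∀ k → fromℤ (+ suc k) ℚ.* inv (suc k) ≡ 1ℚ
fromℤ*inv k = ℚP.toℚᵘ-injective (begin
  toℚᵘ (fromℤ (+ suc k) ℚ.* inv (suc k))          ≈⟨ ℚP.toℚᵘ-homo-* (fromℤ (+ suc k)) (inv (suc k)) ⟩
  toℚᵘ (fromℤ (+ suc k)) ℚᵘ.* toℚᵘ (inv (suc k))  ≈⟨ ℚᵘP.*-cong (toℚᵘ-fromℤ (+ suc k)) (ℚP.toℚᵘ-fromℚᵘ (ℚᵘ.mkℚᵘ (+ 1) k)) ⟩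
  ℚᵘ.mkℚᵘ (+ suc k) 0 ℚᵘ.* ℚᵘ.mkℚᵘ (+ 1) k        ≈⟨ ℚᵘ.*≡* (eq (+ suc k)) ⟩
  toℚᵘ 1ℚ                                          ∎)
  where
  open ℚᵘP.≃-Reasoning
  eq : ∀ m → (m ℤ.* + 1) ℤ.* + 1 ≡ + 1 ℤ.* (+ 1 ℤ.* m)
  eq = ℤ-Ring.solve-∀

infixl 7 _*√_
_*√_ : Q√ → ℕ → Q√
x *√ r = (im x ℚ.* fromℤ (+ r)) + re x √

module _ (k : ℕ) where

  private
    R : ℚ
    R = fromℤ (+ suc k)

    instance
      R-pos : ℚ.Positive R
      R-pos = ℚP.normalize-pos (suc k) 1

      R-nonNeg : ℚ.NonNegative R
      R-nonNeg = ℚP.pos⇒nonNeg R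

  *R-≤⇔ : ∀ {p q} → p ℚ.* R ℚ.≤ q ℚ.* R ⇔ p ℚ.≤ q
  *R-≤⇔ = mk⇔ (ℚP.*-cancelʳ-≤-pos R) (ℚP.*-monoʳ-≤-nonNeg R)

  *R-<⇔ : ∀ {p q} → p ℚ.* R ℚ.< q ℚ.* R ⇔ p ℚ.< q
  *R-<⇔ = mk⇔ (ℚP.*-cancelʳ-<-nonNeg R) (ℚP.*-monoˡ-<-pos R)

  0≤*R⇔0≤ : ∀ {q} → 0ℚ ℚ.≤ q ℚ.* R ⇔ 0ℚ ℚ.≤ q
  0≤*R⇔0≤ {q} = subst (λ z → z ℚ.≤ q ℚ.* R ⇔ 0ℚ ℚ.≤ q) (ℚP.*-zeroˡ R) *R-≤⇔

  *R<0⇔<0 : ∀ {q} → q ℚ.* R ℚ.< 0ℚ ⇔ q ℚ.< 0ℚ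
  *R<0⇔<0 {q} = subst (λ z → q ℚ.* R ℚ.< z ⇔ q ℚ.< 0ℚ) (ℚP.*-zeroˡ R) *R-<⇔

  [q*R]²≡q²*R*R : ∀ q → (q ℚ.* R) ℚ.* (q ℚ.* R) ≡ ((q ℚ.* q) ℚ.* R) ℚ.* R
  [q*R]²≡q²*R*R q = lemma q R
    where
    lemma : ∀ q R → (q ℚ.* R) ℚ.* (q ℚ.* R) ≡ ((q ℚ.* q) ℚ.* R) ℚ.* R
    lemma = solve-∀ ℚ-ring

  [q*R]²≤p²*R⇔q²*R≤p² : ∀ p q → (q ℚ.* R) ℚ.* (q ℚ.* R) ℚ.≤ (p ℚ.* p) ℚ.* R ⇔ (q ℚ.* q) ℚ.* R ℚ.≤ p ℚ.* p
  [q*R]²≤p²*R⇔q²*R≤p² p q =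
    subst (λ z → z ℚ.≤ (p ℚ.* p) ℚ.* R ⇔ (q ℚ.* q) ℚ.* R ℚ.≤ p ℚ.* p) (sym ([q*R]²≡q²*R*R q)) *R-≤⇔

  p²*R≤[q*R]²⇔p²≤q²*R : ∀ p q → (p ℚ.* p) ℚ.* R ℚ.≤ (q ℚ.* R) ℚ.* (q ℚ.* R) ⇔ p ℚ.* p ℚ.≤ (q ℚ.* q) ℚ.* R
  p²*R≤[q*R]²⇔p²≤q²*R p q =
    subst (λ z → (p ℚ.* p) ℚ.* R ℚ.≤ z ⇔ p ℚ.* p ℚ.≤ (q ℚ.* q) ℚ.* R) (sym ([q*R]²≡q²*R*R q)) *R-≤⇔

  NonNeg-*√ : ∀ x → NonNeg (suc k) x ⇔ NonNeg (suc k) (x *√ suc k)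
  NonNeg-*√ x = mk⇔ forward backward
    where
    p q : ℚ
    p = re x
    q = im x

    forward : NonNeg (suc k) x → NonNeg (suc k) (x *√ suc k)
    forward (inj₁ (0≤p , 0≤q)) = inj₁ (from 0≤*R⇔0≤ 0≤q , 0≤p)
    forward (inj₂ (inj₁ (0≤p , q<0 , q²r≤p²))) =
      inj₂ (inj₂ (from *R<0⇔<0 q<0 , 0≤p , from ([q*R]²≤p²*R⇔q²*R≤p² p q) q²r≤p²))
    forward (inj₂ (inj₂ (p<0 , 0≤q , p²≤q²r))) =
      inj₂ (inj₁ (from 0≤*R⇔0≤ 0≤q , p<0 , from (p²*R≤[q*R]²⇔p²≤q²*R p q) p²≤q²r))

    backward : NonNeg (suc k) (x *√ suc k) → NonNeg (suc k) x
    backward (inj₁ (0≤qR , 0≤p)) = inj₁ (0≤p , to 0≤*R⇔0≤ 0≤qR)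
    backward (inj₂ (inj₁ (0≤qR , p<0 , p²r≤[qR]²))) =
      inj₂ (inj₂ (p<0 , to 0≤*R⇔0≤ 0≤qR , to (p²*R≤[q*R]²⇔p²≤q²*R p q) p²r≤[qR]²))
    backward (inj₂ (inj₂ (qR<0 , 0≤p , [qR]²≤p²r))) =
      inj₂ (inj₁ (0≤p , to *R<0⇔<0 qR<0 , to ([q*R]²≤p²*R⇔q²*R≤p² p q) [qR]²≤p²r))

  ≤-*√ : ∀ x y u v → (y ⊖ x) *√ suc k ≡ v ⊖ u → x ≤[ suc k ] y ⇔ u ≤[ suc k ] v
  ≤-*√ x y u v eq = subst (λ z → x ≤[ suc k ] y ⇔ NonNeg (suc k) z) eq (NonNeg-*√ (y ⊖ x))

square-mono-≤ : ∀ {p p'} → 0ℚ ℚ.≤ p → p ℚ.≤ p' → p ℚ.* p ℚ.≤ p' ℚ.* p'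
square-mono-≤ {p} {p'} 0≤p p≤p' = ℚP.≤-trans
  (ℚP.*-monoˡ-≤-nonNeg p {{ℚ.nonNegative 0≤p}} p≤p')
  (ℚP.*-monoʳ-≤-nonNeg p' {{ℚ.nonNegative (ℚP.≤-trans 0≤p p≤p')}} p≤p')

square-antimono-≤ : ∀ {p p'} → p ℚ.≤ p' → p' ℚ.≤ 0ℚ → p' ℚ.* p' ℚ.≤ p ℚ.* p
square-antimono-≤ {p} {p'} p≤p' p'≤0 = subst₂ ℚ._≤_ (neg-square p') (neg-square p)
  (square-mono-≤ (ℚP.neg-antimono-≤ p'≤0) (ℚP.neg-antimono-≤ p≤p'))
  where
  neg-square : ∀ x → (ℚ.- x) ℚ.* (ℚ.- x) ≡ x ℚ.* x
  neg-square = solve-∀ ℚ-ring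

NonNeg-mono-re : ∀ r {p p' q} → p ℚ.≤ p' → NonNeg r (p + q √) → NonNeg r (p' + q √)
NonNeg-mono-re r p≤p' (inj₁ (0≤p , 0≤q)) = inj₁ (ℚP.≤-trans 0≤p p≤p' , 0≤q)
NonNeg-mono-re r p≤p' (inj₂ (inj₁ (0≤p , q<0 , q²r≤p²))) =
  inj₂ (inj₁ (ℚP.≤-trans 0≤p p≤p' , q<0 , ℚP.≤-trans q²r≤p² (square-mono-≤ 0≤p p≤p')))
NonNeg-mono-re r {p' = p'} p≤p' (inj₂ (inj₂ (p<0 , 0≤q , p²≤q²r))) with 0ℚ ℚP.≤? p'
... | yes 0≤p' = inj₁ (0≤p' , 0≤q)
... | no 0≰p' = inj₂ (inj₂ (p'<0 , 0≤q , ℚP.≤-trans (square-antimono-≤ p≤p' (ℚP.<⇒≤ p'<0)) p²≤q²r))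
  where
  p'<0 : p' ℚ.< 0ℚ
  p'<0 = ℚP.≰⇒> 0≰p'

ℤ→Q√-≤-antimono : ∀ r {j m x} → j ℤ.≤ m → ℤ→Q√ m ≤[ r ] x → ℤ→Q√ j ≤[ r ] x
ℤ→Q√-≤-antimono r {x = x} j≤m =
  NonNeg-mono-re r {q = im x ℚ.- 0ℚ} (ℚP.+-monoʳ-≤ (re x) (ℚP.neg-antimono-≤ (fromℤ-mono-≤ j≤m)))

IsFloor-≮ : ∀ {r x j m} → IsFloor r x j → IsFloor r x m → ¬ (j ℤ.< m)
IsFloor-≮ {r} {x} {j} (_ , _ , x≱j+1) (m≤x , _) j<m =
  x≱j+1 (ℤ→Q√-≤-antimono r {x = x} (subst (ℤ._≤ _) (ℤP.+-comm (+ 1) j) (ℤP.i<j⇒suc[i]≤j j<m)) m≤x)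

IsFloor-unique : ∀ {r x j m} → IsFloor r x j → IsFloor r x m → j ≡ m
IsFloor-unique {r} {x} fj fm =
  ℤP.≤-antisym (ℤP.≮⇒≥ (IsFloor-≮ {r} {x} fm fj)) (ℤP.≮⇒≥ (IsFloor-≮ {r} {x} fj fm))

≡⇔IsFloor : ∀ {r x j m} → IsFloor r x j → (j ≡ m ⇔ IsFloor r x m)
≡⇔IsFloor {r} {x} fj = mk⇔ (λ j≡m → subst (IsFloor r x) j≡m fj) (IsFloor-unique {r} {x} fj)

re-sumQ√ : ∀ (f : ℕ → Q√) (g : ℕ → ℤ) → (∀ j → re (f j) ≡ ℚ.- fromℤ (g j)) →
  ∀ k → re (sumQ√ k f) ≡ ℚ.- fromℤ (sumℤ k g)
re-sumQ√ f g hf zero = refl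
re-sumQ√ f g hf (suc k) = begin
  re (sumQ√ k f) ℚ.+ re (f k)                   ≡⟨ cong₂ ℚ._+_ (re-sumQ√ f g hf k) (hf k) ⟩
  ℚ.- fromℤ (sumℤ k g) ℚ.+ ℚ.- fromℤ (g k)      ≡⟨ ℚP.neg-distrib-+ (fromℤ (sumℤ k g)) (fromℤ (g k)) ⟨
  ℚ.- (fromℤ (sumℤ k g) ℚ.+ fromℤ (g k))        ≡⟨ cong ℚ.-_ (fromℤ-homo-+ (sumℤ k g) (g k)) ⟨
  ℚ.- fromℤ (sumℤ k g ℤ.+ g k)                  ∎
  where open ≡-Reasoning

im-sumQ√-arithmetic : ∀ (f : ℕ → Q√) c d → (∀ j → im (f j) ≡ c ℚ.- fromℤ (+ j) ℚ.* d) →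
  ∀ k → let K = fromℤ (+ k) in im (sumQ√ k f) ≡ K ℚ.* c ℚ.- ½ ℚ.* (K ℚ.* (K ℚ.- 1ℚ)) ℚ.* d
im-sumQ√-arithmetic f c d hf zero = base c d
  where
  base : ∀ c d → 0ℚ ≡ 0ℚ ℚ.* c ℚ.- ½ ℚ.* (0ℚ ℚ.* (0ℚ ℚ.- 1ℚ)) ℚ.* d
  base = solve-∀ ℚ-ring
im-sumQ√-arithmetic f c d hf (suc k) = begin
  im (sumQ√ k f) ℚ.+ im (f k)
    ≡⟨ cong₂ ℚ._+_ (im-sumQ√-arithmetic f c d hf k) (hf k) ⟩
  (K ℚ.* c ℚ.- ½ ℚ.* (K ℚ.* (K ℚ.- 1ℚ)) ℚ.* d) ℚ.+ (c ℚ.- K ℚ.* d)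
    ≡⟨ step K c d ⟩
  (1ℚ ℚ.+ K) ℚ.* c ℚ.- ½ ℚ.* ((1ℚ ℚ.+ K) ℚ.* ((1ℚ ℚ.+ K) ℚ.- 1ℚ)) ℚ.* d
    ≡⟨ cong (λ K′ → K′ ℚ.* c ℚ.- ½ ℚ.* (K′ ℚ.* (K′ ℚ.- 1ℚ)) ℚ.* d) (fromℤ-homo-+ (+ 1) (+ k)) ⟨
  fromℤ (+ suc k) ℚ.* c ℚ.- ½ ℚ.* (fromℤ (+ suc k) ℚ.* (fromℤ (+ suc k) ℚ.- 1ℚ)) ℚ.* d ∎
  where
  open ≡-Reasoning
  K : ℚ
  K = fromℤ (+ k)
  step : ∀ K c d → (K ℚ.* c ℚ.- ½ ℚ.* (K ℚ.* (K ℚ.- 1ℚ)) ℚ.* d) ℚ.+ (c ℚ.- K ℚ.* d)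
    ≡ (1ℚ ℚ.+ K) ℚ.* c ℚ.- ½ ℚ.* ((1ℚ ℚ.+ K) ℚ.* ((1ℚ ℚ.+ K) ℚ.- 1ℚ)) ℚ.* d
  step = solve-∀ ℚ-ring

module _ (k : ℕ) where

  private
    r : ℕ
    r = suc k

    R i : ℚ
    R = fromℤ (+ r)
    i = inv r

  im-argA-*R : ∀ m → im (argA r m) ℚ.* R ≡ fromℤ m ℚ.+ + r / 2
  im-argA-*R m = begin
    (M ℚ.* i ℚ.+ ½) ℚ.* R            ≡⟨ regroup M i R ⟩
    M ℚ.* (R ℚ.* i) ℚ.+ R ℚ.* ½      ≡⟨ cong₂ (λ u h → M ℚ.* u ℚ.+ h) (fromℤ*inv k) (sym (/2≡fromℤ*½ (+ r))) ⟩
    M ℚ.* 1ℚ ℚ.+ + r / 2             ≡⟨ cong (ℚ._+ + r / 2) (ℚP.*-identityʳ M) ⟩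
    M ℚ.+ + r / 2                    ∎
    where
    open ≡-Reasoning
    M : ℚ
    M = fromℤ m
    regroup : ∀ M i R → (M ℚ.* i ℚ.+ ½) ℚ.* R ≡ M ℚ.* (R ℚ.* i) ℚ.+ R ℚ.* ½
    regroup = solve-∀ ℚ-ring

  module _ (a : ℤ → ℤ) (n : ℤ) where

    private
      N : ℚ
      N = fromℤ n

    Φ-re : re (Φ r a n) ≡ ℚ.- fromℤ (S r a n)
    Φ-re = re-sumQ√ _ (λ j → a (n ℤ.- + j)) (λ j → ℚP.+-identityˡ _) r

    Φ-im : im (Φ r a n) ≡ N ℚ.+ ½
    Φ-im = begin
      im (Φ r a n)
        ≡⟨ im-sumQ√-arithmetic _ (N ℚ.* i ℚ.+ ½) i summand r ⟩
      R ℚ.* (N ℚ.* i ℚ.+ ½) ℚ.- ½ ℚ.* (R ℚ.* (R ℚ.- 1ℚ)) ℚ.* i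
        ≡⟨ regroup R N i ⟩
      N ℚ.* (R ℚ.* i) ℚ.+ ½ ℚ.* R ℚ.- ½ ℚ.* (R ℚ.- 1ℚ) ℚ.* (R ℚ.* i)
        ≡⟨ cong (λ u → N ℚ.* u ℚ.+ ½ ℚ.* R ℚ.- ½ ℚ.* (R ℚ.- 1ℚ) ℚ.* u) (fromℤ*inv k) ⟩
      N ℚ.* 1ℚ ℚ.+ ½ ℚ.* R ℚ.- ½ ℚ.* (R ℚ.- 1ℚ) ℚ.* 1ℚ
        ≡⟨ simplify N R ⟩
      N ℚ.+ ½ ∎
      where
      open ≡-Reasoning
      summand : ∀ j → im (argA r (n ℤ.- + j) ⊖ ℤ→Q√ (a (n ℤ.- + j))) ≡ (N ℚ.* i ℚ.+ ½) ℚ.- fromℤ (+ j) ℚ.* i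
      summand j = begin
        (fromℤ (n ℤ.- + j) ℚ.* i ℚ.+ ½) ℚ.- 0ℚ
          ≡⟨ cong (λ z → (z ℚ.* i ℚ.+ ½) ℚ.- 0ℚ) (trans (fromℤ-homo-+ n (ℤ.- + j)) (cong (N ℚ.+_) (fromℤ-homo‿- (+ j)))) ⟩
        ((N ℚ.- fromℤ (+ j)) ℚ.* i ℚ.+ ½) ℚ.- 0ℚ
          ≡⟨ distribute N (fromℤ (+ j)) i ⟩
        (N ℚ.* i ℚ.+ ½) ℚ.- fromℤ (+ j) ℚ.* i ∎
        where
        distribute : ∀ N J i → ((N ℚ.- J) ℚ.* i ℚ.+ ½) ℚ.- 0ℚ ≡ (N ℚ.* i ℚ.+ ½) ℚ.- J ℚ.* i
        distribute = solve-∀ ℚ-ring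
      regroup : ∀ R N i → R ℚ.* (N ℚ.* i ℚ.+ ½) ℚ.- ½ ℚ.* (R ℚ.* (R ℚ.- 1ℚ)) ℚ.* i
        ≡ N ℚ.* (R ℚ.* i) ℚ.+ ½ ℚ.* R ℚ.- ½ ℚ.* (R ℚ.- 1ℚ) ℚ.* (R ℚ.* i)
      regroup = solve-∀ ℚ-ring
      simplify : ∀ N R → N ℚ.* 1ℚ ℚ.+ ½ ℚ.* R ℚ.- ½ ℚ.* (R ℚ.- 1ℚ) ℚ.* 1ℚ ≡ N ℚ.+ ½
      simplify = solve-∀ ℚ-ring

    private
      x : Q√
      x = argA r (S r a n)

      scaled-re : (im x ℚ.- 0ℚ) ℚ.* R ≡ + r / 2 ℚ.- re (Φ r a n)
      scaled-re = begin
        (im x ℚ.- 0ℚ) ℚ.* R            ≡⟨ cong (ℚ._* R) (ℚP.+-identityʳ (im x)) ⟩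
        im x ℚ.* R                     ≡⟨ im-argA-*R (S r a n) ⟩
        s ℚ.+ + r / 2                  ≡⟨ swap s (+ r / 2) ⟩
        + r / 2 ℚ.- ℚ.- s              ≡⟨ cong (λ z → + r / 2 ℚ.- z) Φ-re ⟨
        + r / 2 ℚ.- re (Φ r a n)       ∎
        where
        open ≡-Reasoning
        s : ℚ
        s = fromℤ (S r a n)
        swap : ∀ s h → s ℚ.+ h ≡ h ℚ.- ℚ.- s
        swap = solve-∀ ℚ-ring

      N+1 : fromℤ (n ℤ.+ + 1) ≡ N ℚ.+ 1ℚ
      N+1 = fromℤ-homo-+ n (+ 1)

      [x-n]√r≡upperB-Φ : (x ⊖ ℤ→Q√ n) *√ r ≡ upperB r ⊖ Φ r a n
      [x-n]√r≡upperB-Φ = cong₂ _+_√ scaled-re (trans (shift N) (cong (λ z → ½ ℚ.- z) (sym Φ-im)))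
        where
        shift : ∀ N → 0ℚ ℚ.- N ≡ ½ ℚ.- (N ℚ.+ ½)
        shift = solve-∀ ℚ-ring

      [n+1-x]√r≡Φ-lowerB : (ℤ→Q√ (n ℤ.+ + 1) ⊖ x) *√ r ≡ Φ r a n ⊖ lowerB r
      [n+1-x]√r≡Φ-lowerB = cong₂ _+_√
        (trans (negate (im x) R) (trans (cong ℚ.-_ scaled-re) (flip (+ r / 2) (re (Φ r a n)))))
        (trans (cong (ℚ._- 0ℚ) N+1) (trans (shift N) (cong (ℚ._- ℚ.- ½) (sym Φ-im))))
        where
        negate : ∀ y R → (0ℚ ℚ.- y) ℚ.* R ≡ ℚ.- ((y ℚ.- 0ℚ) ℚ.* R)
        negate = solve-∀ ℚ-ring
        flip : ∀ h p → ℚ.- (h ℚ.- p) ≡ p ℚ.- h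
        flip = solve-∀ ℚ-ring
        shift : ∀ N → (N ℚ.+ 1ℚ) ℚ.- 0ℚ ≡ (N ℚ.+ ½) ℚ.- ℚ.- ½
        shift = solve-∀ ℚ-ring

      [x-n-1]√r≡lowerB-Φ : (x ⊖ ℤ→Q√ (n ℤ.+ + 1)) *√ r ≡ lowerB r ⊖ Φ r a n
      [x-n-1]√r≡lowerB-Φ = cong₂ _+_√ scaled-re
        (trans (cong (λ z → 0ℚ ℚ.- z) N+1) (trans (shift N) (cong (λ z → ℚ.- ½ ℚ.- z) (sym Φ-im))))
        where
        shift : ∀ N → 0ℚ ℚ.- (N ℚ.+ 1ℚ) ≡ ℚ.- ½ ℚ.- (N ℚ.+ ½)
        shift = solve-∀ ℚ-ring

    IsFloor⇔Φ-bounds : IsFloor r (argA r (S r a n)) n ⇔ (lowerB r <[ r ] Φ r a n × Φ r a n ≤[ r ] upperB r)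
    IsFloor⇔Φ-bounds = mk⇔
      (λ (n≤x , x≤n+1 , x≰n+1) → (to lower x≤n+1 , x≰n+1 ∘ from lower′) , to upper n≤x)
      (λ ((lowerB≤Φ , Φ≰lowerB) , Φ≤upperB) → from upper Φ≤upperB , from lower lowerB≤Φ , Φ≰lowerB ∘ to lower′)
      where
      upper : ℤ→Q√ n ≤[ r ] x ⇔ Φ r a n ≤[ r ] upperB r
      upper = ≤-*√ k (ℤ→Q√ n) x (Φ r a n) (upperB r) [x-n]√r≡upperB-Φ
      lower : x ≤[ r ] ℤ→Q√ (n ℤ.+ + 1) ⇔ lowerB r ≤[ r ] Φ r a n
      lower = ≤-*√ k x (ℤ→Q√ (n ℤ.+ + 1)) (lowerB r) (Φ r a n) [n+1-x]√r≡Φ-lowerB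
      lower′ : ℤ→Q√ (n ℤ.+ + 1) ≤[ r ] x ⇔ Φ r a n ≤[ r ] lowerB r
      lower′ = ≤-*√ k (ℤ→Q√ (n ℤ.+ + 1)) x (Φ r a n) (lowerB r) [x-n-1]√r≡lowerB-Φ

proposition3p2 : (r : ℕ) → 2 ≤ r →
    (a : ℤ → ℤ) → (∀ m → IsFloor r (argA r m) (a m)) →
    (n : ℤ) → + r ℤ.≤ n →
    (a (S r a n) ≡ n) ⇔ (lowerB r <[ r ] Φ r a n × Φ r a n ≤[ r ] upperB r)
proposition3p2 zero () _ _ _ _
proposition3p2 (suc k) _ a floor n _ =
  IsFloor⇔Φ-bounds k a n ⇔-∘ ≡⇔IsFloor {suc k} {argA (suc k) (S (suc k) a n)} (floor (S (suc k) a n))
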